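{- If a graph $G$ is triangle-free, then the blow-up graph $G[K_2]$ contains neither $W_5$ nor $W_6$ as a subgraph.
   Context: For graphs $G$ and $H$, the blow-up $G[H]$ is obtained by replacing each vertex of $G$ with a copy of $H$; two vertices in different copies are adjacent if and only if the corresponding vertices of $G$ are adjacent (vertices within the same copy are adjacent exactly as in $H$). The wheel $W_k$ is the graph on $k$ vertices obtained by adding a new vertex adjacent to every vertex of the cycle $C_{k-1}$. -}

module Defs where

open import Data.Nat using (ℕ; zero; suc; _+_; _%_)
open import Data.Fin using (Fin; toℕ)
import Data.Fin as F
open import Data.Unit using (⊤)
open import Data.Product using (_×_; _,_; ∃)
open import Data.Sum using (_⊎_)
open import Data.Empty using (⊥)
open import Relation.Nullary using (¬_)
open import Relation.Binary.PropositionalEquality using (_≡_)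
open import Function.Definitions using (Injective)

record Graph (n : ℕ) : Set₁ where
  field
    Adj    : Fin n → Fin n → Set
    sym    : ∀ {u v} → Adj u v → Adj v u
    irrefl : ∀ {u} → ¬ Adj u u
open Graph public

TriangleFree : ∀ {n} → Graph n → Set
TriangleFree G = ∀ u v w → Adj G u v → Adj G v w → Adj G u w → ⊥

SubgraphOf : ∀ {k} {V : Set} → (Fin k → Fin k → Set) → (V → V → Set) → Set
SubgraphOf {k} {V} H R =
  ∃ λ (f : Fin k → V) → Injective _≡_ _≡_ f × (∀ u v → H u v → R (f u) (f v))

-- Blow-up G[K_2]: vertex set Fin n × Fin 2 (copy i ∈ Fin 2 of vertex v).
-- (u , i) ~ (v , j) iff uv ∈ E(G), or u = v and i ≠ j (the edge of K_2).
BlowK2Adj : ∀ {n} → Graph n → (Fin n × Fin 2) → (Fin n × Fin 2) → Set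
BlowK2Adj G (u , i) (v , j) = Adj G u v ⊎ (u ≡ v × ¬ i ≡ j)

-- Cycle C_m on Fin m (used for m ≥ 3): i ~ j iff j ≡ i+1 or i ≡ j+1 (mod m).
CycleAdj : (m : ℕ) → Fin m → Fin m → Set
CycleAdj zero () _
CycleAdj (suc m) i j =
  toℕ j ≡ (toℕ i + 1) % suc m ⊎ toℕ i ≡ (toℕ j + 1) % suc m

-- Wheel W_k on Fin k: vertex zero is the hub, adjacent to every other vertex;
-- vertices suc i and suc j are adjacent as in the cycle C_{k-1}.
WheelAdj : (k : ℕ) → Fin k → Fin k → Set
WheelAdj zero () _
WheelAdj (suc m) F.zero F.zero = ⊥
WheelAdj (suc m) F.zero (F.suc _) = ⊤
WheelAdj (suc m) (F.suc _) F.zero = ⊤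
WheelAdj (suc m) (F.suc i) (F.suc j) = CycleAdj m i j

-- By triangle-freeness of G, every triangle of G[K₂] has two vertices in one
-- fibre {v} × Fin 2, and a fibre has only two vertices. In a wheel W_k the hub
-- and a rim edge form a triangle, so a rim edge avoiding the hub's fibre lies in
-- a single fibre. At most one rim vertex shares the hub's fibre, so some three
-- consecutive rim vertices (k ≥ 5) avoid it and would all lie in one fibre.
module Submission where

open import Defs hiding (sym)
open import Data.Nat as ℕ using (ℕ)
open import Data.Fin using (Fin; zero; suc; _≟_)
open import Data.Fin.Properties using (suc-injective)
import Data.Fin.Literals as FinLiterals
import Data.Nat.Literals as ℕLiterals
open import Agda.Builtin.FromNat using (Number; fromNat)
open import Data.Product using (_×_; _,_; proj₁)
open import Data.Sum using (_⊎_; inj₁; inj₂)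
open import Data.Unit using (tt)
open import Data.Empty using (⊥)
open import Function using (_∘_)
open import Function.Definitions using (Injective)
open import Relation.Nullary using (¬_; yes; no; contradiction)
open import Relation.Binary.PropositionalEquality using (_≡_; refl; sym; trans; cong₂)

instance
  ℕNumber : Number ℕ
  ℕNumber = ℕLiterals.number

  finNumber : ∀ {n} → Number (Fin n)
  finNumber {n} = FinLiterals.number n

fin2-pigeonhole : (i j k : Fin 2) → i ≡ j ⊎ j ≡ k ⊎ i ≡ k
fin2-pigeonhole zero       zero       _          = inj₁ refl
fin2-pigeonhole (suc zero) (suc zero) _          = inj₁ refl
fin2-pigeonhole zero       (suc zero) zero       = inj₂ (inj₂ refl)
fin2-pigeonhole zero       (suc zero) (suc zero) = inj₂ (inj₁ refl)
fin2-pigeonhole (suc zero) zero       zero       = inj₂ (inj₁ refl)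
fin2-pigeonhole (suc zero) zero       (suc zero) = inj₂ (inj₂ refl)

fibre-pigeonhole : ∀ {A : Set} (p q r : A × Fin 2) →
  proj₁ p ≡ proj₁ q → proj₁ q ≡ proj₁ r → p ≡ q ⊎ q ≡ r ⊎ p ≡ r
fibre-pigeonhole (x , i) (y , j) (z , k) x≡y y≡z with fin2-pigeonhole i j k
... | inj₁ i≡j        = inj₁ (cong₂ _,_ x≡y i≡j)
... | inj₂ (inj₁ j≡k) = inj₂ (inj₁ (cong₂ _,_ y≡z j≡k))
... | inj₂ (inj₂ i≡k) = inj₂ (inj₂ (cong₂ _,_ (trans x≡y y≡z) i≡k))

module _ {n : ℕ} (G : Graph n) where

  blowK2-adj⇒≢ : ∀ {p q} → BlowK2Adj G p q → ¬ p ≡ q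
  blowK2-adj⇒≢ (inj₁ uu)        refl = irrefl G uu
  blowK2-adj⇒≢ (inj₂ (_ , i≢i)) refl = i≢i refl

  blowK2-triangle-fibre : TriangleFree G → ∀ {p q r} →
    BlowK2Adj G p q → BlowK2Adj G q r → BlowK2Adj G p r →
    proj₁ p ≡ proj₁ q ⊎ proj₁ q ≡ proj₁ r ⊎ proj₁ p ≡ proj₁ r
  blowK2-triangle-fibre _ (inj₂ (u≡v , _)) _                _                = inj₁ u≡v
  blowK2-triangle-fibre _ (inj₁ _)         (inj₂ (v≡w , _)) _                = inj₂ (inj₁ v≡w)
  blowK2-triangle-fibre _ (inj₁ _)         (inj₁ _)         (inj₂ (u≡w , _)) = inj₂ (inj₂ u≡w)
  blowK2-triangle-fibre triangle-free {u , _} {v , _} {w , _} (inj₁ uv) (inj₁ vw) (inj₁ uw) =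
    contradiction (triangle-free u v w uv vw uw) λ ()

  module Embedding (triangle-free : TriangleFree G) {k : ℕ} {H : Fin k → Fin k → Set}
    (f : Fin k → Fin n × Fin 2) (f-injective : Injective _≡_ _≡_ f)
    (f-hom : ∀ a b → H a b → BlowK2Adj G (f a) (f b)) where

    π : Fin k → Fin n
    π = proj₁ ∘ f

    fibre-path⇒≡ : ∀ {a b c} → H a b → H b c → π a ≡ π b → π b ≡ π c → a ≡ c
    fibre-path⇒≡ {a} {b} {c} ab bc πa≡πb πb≡πc
      with fibre-pigeonhole (f a) (f b) (f c) πa≡πb πb≡πc
    ... | inj₁ fa≡fb        = contradiction fa≡fb (blowK2-adj⇒≢ (f-hom a b ab))
    ... | inj₂ (inj₁ fb≡fc) = contradiction fb≡fc (blowK2-adj⇒≢ (f-hom b c bc))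
    ... | inj₂ (inj₂ fa≡fc) = f-injective fa≡fc

    triangle-off-fibre : ∀ {h a b} → H h a → H a b → H h b →
      ¬ π h ≡ π a → ¬ π h ≡ π b → π a ≡ π b
    triangle-off-fibre {h} {a} {b} ha ab hb h≁a h≁b
      with blowK2-triangle-fibre triangle-free (f-hom h a ha) (f-hom a b ab) (f-hom h b hb)
    ... | inj₁ πh≡πa        = contradiction πh≡πa h≁a
    ... | inj₂ (inj₁ πa≡πb) = πa≡πb
    ... | inj₂ (inj₂ πh≡πb) = contradiction πh≡πb h≁b

    fan-path⇒≡ : ∀ {h a b c} → H h a → H h b → H h c → H a b → H b c →
      ¬ π h ≡ π a → ¬ π h ≡ π b → ¬ π h ≡ π c → a ≡ c
    fan-path⇒≡ ha hb hc ab bc h≁a h≁b h≁c =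
      fibre-path⇒≡ ab bc (triangle-off-fibre ha ab hb h≁a h≁b)
                         (triangle-off-fibre hb bc hc h≁b h≁c)

  module WheelEmbedding (triangle-free : TriangleFree G) {m : ℕ}
    (f : Fin (ℕ.suc m) → Fin n × Fin 2) (f-injective : Injective _≡_ _≡_ f)
    (f-hom : ∀ a b → WheelAdj (ℕ.suc m) a b → BlowK2Adj G (f a) (f b)) where

    open Embedding triangle-free f f-injective f-hom public

    hub : Fin n
    hub = π zero

    rim : Fin m → Fin n
    rim i = π (suc i)

    hub-fibre-unique : ∀ {i j} → hub ≡ rim i → hub ≡ rim j → i ≡ j
    hub-fibre-unique h∼i h∼j = suc-injective (fibre-path⇒≡ tt tt (sym h∼i) h∼j)

    hub-fibre-elsewhere : ∀ {i j} → hub ≡ rim i → ¬ i ≡ j → ¬ hub ≡ rim j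
    hub-fibre-elsewhere h∼i i≢j h∼j = i≢j (hub-fibre-unique h∼i h∼j)

    rim-path⇒≡ : ∀ {i j l} → CycleAdj m i j → CycleAdj m j l →
      ¬ hub ≡ rim i → ¬ hub ≡ rim j → ¬ hub ≡ rim l → i ≡ l
    rim-path⇒≡ ij jl h≁i h≁j h≁l = suc-injective (fan-path⇒≡ tt tt tt ij jl h≁i h≁j h≁l)

  no-W5 : TriangleFree G → ¬ SubgraphOf (WheelAdj 5) (BlowK2Adj G)
  no-W5 triangle-free (f , f-injective , f-hom) = by-hub-fibre
    where
    open WheelEmbedding triangle-free f f-injective f-hom
    by-hub-fibre : ⊥
    by-hub-fibre with hub ≟ rim 0
    ... | yes h∼0 with () ← rim-path⇒≡ {1} {2} {3} (inj₁ refl) (inj₁ refl)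
          (hub-fibre-elsewhere h∼0 λ ()) (hub-fibre-elsewhere h∼0 λ ()) (hub-fibre-elsewhere h∼0 λ ())
    ... | no h≁0 with hub ≟ rim 2
    ...   | yes h∼2 with () ← rim-path⇒≡ {3} {0} {1} (inj₁ refl) (inj₁ refl)
            (hub-fibre-elsewhere h∼2 λ ()) h≁0 (hub-fibre-elsewhere h∼2 λ ())
    ...   | no h≁2 with hub ≟ rim 1
    ...     | yes h∼1 with () ← rim-path⇒≡ {2} {3} {0} (inj₁ refl) (inj₁ refl)
              h≁2 (hub-fibre-elsewhere h∼1 λ ()) h≁0
    ...     | no h≁1 with () ← rim-path⇒≡ {0} {1} {2} (inj₁ refl) (inj₁ refl) h≁0 h≁1 h≁2

  no-W6 : TriangleFree G → ¬ SubgraphOf (WheelAdj 6) (BlowK2Adj G)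
  no-W6 triangle-free (f , f-injective , f-hom) = by-hub-fibre
    where
    open WheelEmbedding triangle-free f f-injective f-hom
    by-hub-fibre : ⊥
    by-hub-fibre with hub ≟ rim 0
    ... | yes h∼0 with () ← rim-path⇒≡ {1} {2} {3} (inj₁ refl) (inj₁ refl)
          (hub-fibre-elsewhere h∼0 λ ()) (hub-fibre-elsewhere h∼0 λ ()) (hub-fibre-elsewhere h∼0 λ ())
    ... | no h≁0 with hub ≟ rim 1
    ...   | yes h∼1 with () ← rim-path⇒≡ {2} {3} {4} (inj₁ refl) (inj₁ refl)
            (hub-fibre-elsewhere h∼1 λ ()) (hub-fibre-elsewhere h∼1 λ ()) (hub-fibre-elsewhere h∼1 λ ())
    ...   | no h≁1 with hub ≟ rim 2
    ...     | yes h∼2 with () ← rim-path⇒≡ {3} {4} {0} (inj₁ refl) (inj₁ refl)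
              (hub-fibre-elsewhere h∼2 λ ()) (hub-fibre-elsewhere h∼2 λ ()) h≁0
    ...     | no h≁2 with () ← rim-path⇒≡ {0} {1} {2} (inj₁ refl) (inj₁ refl) h≁0 h≁1 h≁2

lemma12 : ∀ {n : ℕ} (G : Graph n) → TriangleFree G →
    ¬ SubgraphOf (WheelAdj 5) (BlowK2Adj G) × ¬ SubgraphOf (WheelAdj 6) (BlowK2Adj G)
lemma12 G triangle-free = no-W5 G triangle-free , no-W6 G triangle-free
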